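{- Let $r$ be a relation over a schema context on $U$, let $g$ be a reality, $X\subseteq U$ and $A\in U$. Then $r\models_g X\to A$ if and only if $L_r\models_g X\to A$.
   Context: A relation scheme is a finite set $U=\{A_1,\dots,A_n\}$ of attributes with domains $\mathrm{dom}(A)$. A schema context assigns to each $A$ a finite lattice $L_A$ (bottom $0_A$, top $1_A$) and a surjective comparability function $f_A:\mathrm{dom}(A)^2\to L_A$ with $f_A(u,u)=1_A$, $f_A(u,v)=f_A(v,u)$. $L_U=\prod_A L_A$ (componentwise order). A relation $r$ is a finite set of tuples; $f_U(t_1,t_2)=\langle f_{A_i}(t_1[A_i],t_2[A_i])\rangle_i$, $f_U(r)=\{f_U(t_1,t_2):t_1,t_2\in r\}$, $L_r=\{\bigwedge T: T\subseteq f_U(r)\}$ (empty meet = top). An attribute interpretation is an increasing $h_A:L_A\to\{0,1\}$ with $h_A(0_A)=0,h_A(1_A)=1$; a schema interpretation is $g(z)=\langle h_{A_1}(z[A_1]),\dots,h_{A_n}(z[A_n])\rangle$, identified with the subset of $U$ where it equals $1$. A reality is a schema interpretation that is a $\wedge$-homomorphism into $\{0,1\}^n$. $r\models_g X\to A$ means: for all $x\in f_U(r)$, $X\subseteq g(x)$ implies $A\in g(x)$. $L_r\models_g X\to A$ means: for all $x\in L_r$, $X\subseteq g(x)$ implies $A\in g(x)$. -}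

module Defs where

open import Level using (0ℓ)
open import Data.Nat using (ℕ)
open import Data.Fin using (Fin)
open import Data.Fin.Subset using (Subset; _∈_; _⊆_; _∩_)
open import Data.Bool using (Bool; true; false) renaming (_≤_ to _≤ᵇ_)
open import Data.Vec using (tabulate)
open import Data.List using (List; []; _∷_)
open import Data.List.Relation.Unary.All using (All)
import Data.List.Membership.Propositional as LMem
open import Data.Product using (Σ; ∃; ∃-syntax; _×_)
open import Relation.Binary.PropositionalEquality using (_≡_)
open import Relation.Binary.Lattice.Bundles using (BoundedLattice)

record FiniteLattice : Set₁ where
  field
    bLattice : BoundedLattice 0ℓ 0ℓ 0ℓ
  open BoundedLattice bLattice public
  field
    finite : ∃[ k ] Σ (Fin k → Carrier) (λ e → ∀ x → ∃[ i ] e i ≈ x)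

-- A schema context on the relation scheme U = Fin n.
record SchemaContext (n : ℕ) : Set₁ where
  field
    dom  : Fin n → Set
    L    : Fin n → FiniteLattice
  module L (A : Fin n) = FiniteLattice (L A)
  field
    f         : (A : Fin n) → dom A → dom A → L.Carrier A
    f-surj    : (A : Fin n) → (l : L.Carrier A) → ∃[ u ] ∃[ v ] L._≈_ A (f A u v) l
    f-refl    : (A : Fin n) → (u : dom A) → L._≈_ A (f A u u) (L.⊤ A)
    f-sym     : (A : Fin n) → (u v : dom A) → L._≈_ A (f A u v) (f A v u)

module _ {n : ℕ} (S : SchemaContext n) where
  open SchemaContext S

  LU : Set
  LU = (A : Fin n) → L.Carrier A

  _∧U_ : LU → LU → LU
  (x ∧U y) A = L._∧_ A (x A) (y A)

  ⊤U : LU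
  ⊤U A = L.⊤ A

  ⋀ : List LU → LU
  ⋀ []       = ⊤U
  ⋀ (x ∷ xs) = x ∧U ⋀ xs

  Tuple : Set
  Tuple = (A : Fin n) → dom A

  -- A relation: a finite set of tuples, given as a list.
  Relation : Set
  Relation = List Tuple

  fU : Tuple → Tuple → LU
  fU t₁ t₂ A = f A (t₁ A) (t₂ A)

  InFU : Relation → LU → Set
  InFU r x = ∃[ t₁ ] ∃[ t₂ ] (t₁ LMem.∈ r × t₂ LMem.∈ r × x ≡ fU t₁ t₂)

  InLr : Relation → LU → Set
  InLr r x = ∃[ T ] (All (InFU r) T × x ≡ ⋀ T)

  record AttrInterp (A : Fin n) : Set where
    field
      h      : L.Carrier A → Bool
      mono   : ∀ {x y} → L._≤_ A x y → h x ≤ᵇ h y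
      h-bot  : h (L.⊥ A) ≡ false
      h-top  : h (L.⊤ A) ≡ true

  SchemaInterp : Set
  SchemaInterp = (A : Fin n) → AttrInterp A

  -- g(z), identified with the subset of U where it equals 1.
  apply : SchemaInterp → LU → Subset n
  apply g z = tabulate (λ A → AttrInterp.h (g A) (z A))

  IsReality : SchemaInterp → Set
  IsReality g = ∀ x y → apply g (x ∧U y) ≡ apply g x ∩ apply g y

  SatRel : Relation → SchemaInterp → Subset n → Fin n → Set
  SatRel r g X A = ∀ x → InFU r x → X ⊆ apply g x → A ∈ apply g x

  SatLr : Relation → SchemaInterp → Subset n → Fin n → Set
  SatLr r g X A = ∀ x → InLr r x → X ⊆ apply g x → A ∈ apply g x

module Submission where

-- Everything reduces to one observation about subsets of U: the sets s
-- "validating" X → A (X ⊆ s implies A ∈ s) contain the full set and are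
-- closed under intersection.  A reality maps the top of L_U to the full set
-- and meets to intersections, so the g-images validating X → A are closed
-- under finite meets (empty meet = top).  Hence validity on f_U(r) passes to
-- every element ⋀ T of L_r.  Conversely each x ∈ f_U(r) yields the element
-- ⋀ [ x ] = x ∧ ⊤ of L_r, whose g-image equals that of x.

open import Defs
open import Data.Nat using (ℕ)
open import Data.Bool using (true)
open import Data.Fin using (Fin)
open import Data.Fin.Subset using (Subset; _∈_; _⊆_; _∩_; ⊤)
open import Data.Fin.Subset.Properties using (∈⊤; p∩q⊆p; p∩q⊆q; x∈p∩q⁺; ∩-identityʳ)
open import Data.Vec using (lookup; tabulate)
open import Data.Vec.Properties using (tabulate-cong; tabulate∘lookup; lookup-replicate)
open import Data.List using (List; []; _∷_)
open import Data.List.Relation.Unary.All as All using (All; []; _∷_)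
open import Data.Product using (_,_)
open import Function using (_∘_)
open import Function.Bundles using (_⇔_; mk⇔)
open import Relation.Binary.PropositionalEquality
  using (_≡_; refl; sym; trans; cong; subst; module ≡-Reasoning)

Validates : {n : ℕ} → Subset n → Fin n → Subset n → Set
Validates X A s = X ⊆ s → A ∈ s

validates-⊤ : {n : ℕ} {X : Subset n} {A : Fin n} → Validates X A ⊤
validates-⊤ _ = ∈⊤

validates-∩ : {n : ℕ} {X : Subset n} {A : Fin n} {s t : Subset n}
  → Validates X A s → Validates X A t → Validates X A (s ∩ t)
validates-∩ {s = s} {t} vs vt X⊆s∩t =
  x∈p∩q⁺ (vs (p∩q⊆p s t ∘ X⊆s∩t) , vt (p∩q⊆q s t ∘ X⊆s∩t))

module _ {n : ℕ} (S : SchemaContext n) (g : SchemaInterp S) where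

  apply-⊤U : apply S g (⊤U S) ≡ ⊤
  apply-⊤U = begin
    tabulate (λ A → AttrInterp.h (g A) (⊤U S A))
      ≡⟨ tabulate-cong (λ A → trans (AttrInterp.h-top (g A)) (sym (lookup-replicate A true))) ⟩
    tabulate (lookup ⊤)
      ≡⟨ tabulate∘lookup ⊤ ⟩
    ⊤ ∎
    where open ≡-Reasoning

  module _ (reality : IsReality S g) where

    apply-∧⊤U : ∀ x → apply S g (_∧U_ S x (⊤U S)) ≡ apply S g x
    apply-∧⊤U x = begin
      apply S g (_∧U_ S x (⊤U S))   ≡⟨ reality x (⊤U S) ⟩
      apply S g x ∩ apply S g (⊤U S) ≡⟨ cong (apply S g x ∩_) apply-⊤U ⟩
      apply S g x ∩ ⊤               ≡⟨ ∩-identityʳ (apply S g x) ⟩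
      apply S g x ∎
      where open ≡-Reasoning

    validates-⋀ : {X : Subset n} {A : Fin n} (T : List (LU S))
      → All (Validates X A ∘ apply S g) T → Validates X A (apply S g (⋀ S T))
    validates-⋀ []       []         = subst (Validates _ _) (sym apply-⊤U) validates-⊤
    validates-⋀ (y ∷ ys) (vy ∷ vys) =
      subst (Validates _ _) (sym (reality y (⋀ S ys))) (validates-∩ vy (validates-⋀ ys vys))

singleton-InLr : {n : ℕ} (S : SchemaContext n) {r : Relation S} {x : LU S}
  → InFU S r x → InLr S r (_∧U_ S x (⊤U S))
singleton-InLr S {x = x} x∈fUr = x ∷ [] , x∈fUr ∷ [] , refl

proposition7 : {n : ℕ} (S : SchemaContext n) (r : Relation S) (g : SchemaInterp S)
    → IsReality S g → (X : Subset n) (A : Fin n)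
    → SatRel S r g X A ⇔ SatLr S r g X A
proposition7 S r g reality X A = mk⇔ toLr fromLr
  where
  toLr : SatRel S r g X A → SatLr S r g X A
  toLr sat x (T , T⊆fUr , refl) = validates-⋀ S g reality T (All.map (λ {y} → sat y) T⊆fUr)

  -- f_U(r) sits inside L_r up to meeting with the top, which g does not see.
  fromLr : SatLr S r g X A → SatRel S r g X A
  fromLr sat x x∈fUr =
    subst (Validates X A) (apply-∧⊤U S g reality x) (sat _ (singleton-InLr S x∈fUr))
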